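{- For every positive integer $n$, $\mathrm{ex}^*(n, P_5) \leq 4n$.
   Context: An edge-coloring is proper if any two edges sharing a vertex receive different colors. An edge-colored subgraph is rainbow if no two of its edges have the same color. $P_5$ denotes the path with $5$ edges ($6$ vertices). $\mathrm{ex}^*(n,F)$ is the maximum number of edges in an $n$-vertex simple graph with a proper edge-coloring containing no rainbow copy of $F$. -}

module Defs where

open import Data.Nat using (ℕ; _<ᵇ_)
open import Data.Bool using (Bool; true; false; T; _∧_; if_then_else_)
open import Data.Fin using (Fin; toℕ; inject₁; suc)
open import Data.Nat.ListAction using (sum)
open import Data.List using (List; map; cartesianProduct; allFin)
open import Data.Product using (_×_; _,_)
open import Relation.Binary.PropositionalEquality using (_≡_; _≢_)
open import Function.Definitions using (Injective)

record SimpleGraph (n : ℕ) : Set where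
  field
    adj   : Fin n → Fin n → Bool
    sym   : ∀ i j → adj i j ≡ adj j i
    irrefl : ∀ i → adj i i ≡ false
open SimpleGraph public

edgeCount : ∀ {n} → SimpleGraph n → ℕ
edgeCount {n} G =
  sum (map (λ { (i , j) → if (toℕ i <ᵇ toℕ j) ∧ adj G i j then 1 else 0 })
           (cartesianProduct (allFin n) (allFin n)))

-- An edge-colouring with colours in ℕ: a colour for each ordered pair,
-- required to be symmetric on edges (so it colours the unordered edges).
record EdgeColouring {n : ℕ} (G : SimpleGraph n) : Set where
  field
    col    : Fin n → Fin n → ℕ
    colSym : ∀ i j → T (adj G i j) → col i j ≡ col j i
open EdgeColouring public

Proper : ∀ {n} {G : SimpleGraph n} → EdgeColouring G → Set
Proper {n} {G} c = ∀ (i j k : Fin n) → T (adj G i j) → T (adj G i k) → j ≢ k →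
  col c i j ≢ col c i k

-- A rainbow copy of P₅ (path with 5 edges, 6 vertices): six distinct vertices
-- v 0 … v 5, consecutive ones adjacent, and the 5 edge colours pairwise distinct.
RainbowP5 : ∀ {n} {G : SimpleGraph n} → EdgeColouring G → Set
RainbowP5 {n} {G} c =
  Data.Product.Σ (Fin 6 → Fin n) λ v →
    Injective _≡_ _≡_ v
    × (∀ (k : Fin 5) → T (adj G (v (inject₁ k)) (v (suc k))))
    × Injective _≡_ _≡_ (λ (k : Fin 5) → col c (v (inject₁ k)) (v (suc k)))

{-# OPTIONS --safe #-}
-- Peeling off a vertex of degree at most 4 loses at most 4 edges, so it suffices to show that
-- every vertex set A inducing minimum degree at least 5 spans at most 4|A| edges. Call a vertex
-- big if it has at least 8 neighbours in A. A big vertex cannot start a rainbow path with four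
-- edges: it has a neighbour avoiding the four other vertices and the three other colours, which
-- would extend the path to a rainbow P₅. With minimum degree 5 this forces the far end r of every
-- rainbow path v p q r starting at a big v to be adjacent to p and v and to have degree at most 5;
-- hence every vertex at distance at most 2 from a big vertex has degree at most 5, so no two big
-- vertices are adjacent and no vertex has two big neighbours. Discharging: every edge gives one unit to each endpoint, except that an edge at a
-- big vertex gives both units to its other endpoint. Big vertices then receive nothing and all
-- other vertices at most 7 + 1, so twice the number of edges is at most 8|A|.
module Submission where

open import Defs hiding (sym)
open import Data.Bool using (Bool; true; false; T; _∧_; not; if_then_else_)
open import Data.Bool.Properties using (T-∧; T-≡; T-not-≡)
open import Data.Empty using (⊥; ⊥-elim)
open import Data.Fin using (Fin; zero; suc; toℕ; inject₁)
open import Data.Fin.Properties using (_≟_; toℕ-injective; suc-injective; any?)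
open import Data.List using (List; []; _∷_; map; length; tabulate; allFin; cartesianProduct; _++_)
open import Data.List.Properties using (map-tabulate; map-++; map-∘)
open import Data.List.Membership.Propositional using (_∈_)
import Data.List.Membership.DecPropositional as DecMembership
open import Data.List.Relation.Unary.All using (All; []; _∷_)
import Data.List.Relation.Unary.All.Properties as All
open import Data.List.Relation.Unary.AllPairs using (AllPairs; []; _∷_)
open import Data.List.Relation.Unary.Any using (here; there)
import Data.Nat as ℕ
open import Data.Nat using (ℕ; zero; suc; _+_; _*_; _≤_; _<_; _≤?_; z≤n; _<ᵇ_)
open import Data.Nat.Properties
  using ( ≤-refl; ≤-reflexive; ≤-trans; ≤-antisym; ≤-pred; <-irrefl; <⇒≤; ≤⇒≯; <⇒≯; ≮⇒≥; ≰⇒>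
        ; <ᵇ⇒<; <⇒<ᵇ; m≤m+n; m≤n+m; +-comm; +-identityʳ; +-mono-≤; +-monoʳ-≤
        ; *-assoc; *-suc; *-identityˡ; *-zeroʳ; *-monoˡ-≤; *-monoʳ-≤; *-cancelˡ-≡; *-cancelˡ-≤
        ; +-*-semiring; module ≤-Reasoning)
open import Algebra.Properties.Semiring.Sum +-*-semiring
  using (sum; sum-syntax; sum-cong-≗; sum-replicate-zero; ∑-distrib-+; ∑-comm; *-distribˡ-sum; *-distribʳ-sum)
import Data.Nat.ListAction as List
open import Data.Nat.ListAction.Properties using (sum-++)
open import Data.Product using (_×_; _,_; proj₁; proj₂; ∃-syntax)
import Data.Vec as Vec
open import Data.Vec using (_∷_; [])
open import Function using (_∘_; id; Equivalence)
open import Function.Definitions using (Injective)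
open import Relation.Binary.PropositionalEquality
  using (_≡_; _≢_; refl; sym; trans; cong; cong₂; subst; ≢-sym; ≡-≟-identity; module ≡-Reasoning)
open import Relation.Nullary using (¬_; yes; no; contradiction)
open import Relation.Nullary.Decidable using (⌊_⌋; toWitness; toWitnessFalse; fromWitness; T?; _×-dec_; ¬?)

[_] : Bool → ℕ
[ b ] = if b then 1 else 0

T⇒[]≡1 : ∀ {b} → T b → [ b ] ≡ 1
T⇒[]≡1 {true} _ = refl

≡true⇒T : ∀ {b} → b ≡ true → T b
≡true⇒T = Equivalence.from T-≡

[∧]≤ʳ : ∀ a b → [ a ∧ b ] ≤ [ b ]
[∧]≤ʳ true  b = ≤-refl
[∧]≤ʳ false b = z≤n

AtMostOne : ∀ {m} → (Fin m → Bool) → Set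
AtMostOne b = ∀ i j → T (b i) → T (b j) → i ≡ j

∑-mono-≤ : ∀ {m} {f g : Fin m → ℕ} → (∀ i → f i ≤ g i) → sum f ≤ sum g
∑-mono-≤ {zero}  _   = z≤n
∑-mono-≤ {suc m} f≤g = +-mono-≤ (f≤g zero) (∑-mono-≤ (f≤g ∘ suc))

∑-one : ∀ m → ∑[ i < m ] 1 ≡ m
∑-one zero    = refl
∑-one (suc m) = cong suc (∑-one m)

term≤∑ : ∀ {m} (f : Fin m → ℕ) i → f i ≤ sum f
term≤∑ f zero    = m≤m+n _ _
term≤∑ f (suc i) = ≤-trans (term≤∑ (f ∘ suc) i) (m≤n+m _ _)

∑-AtMostOne≤1 : ∀ {m} (b : Fin m → Bool) → AtMostOne b → ∑[ i < m ] [ b i ] ≤ 1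
∑-AtMostOne≤1 {zero}  b unique = z≤n
∑-AtMostOne≤1 {suc m} b unique with b zero in b₀
... | true  = ≤-reflexive (cong suc (trans (sum-cong-≗ rest-empty) (sum-replicate-zero m)))
  where
  rest-empty : ∀ i → [ b (suc i) ] ≡ 0
  rest-empty i with b (suc i) in bᵢ
  ... | false = refl
  ... | true  with unique zero (suc i) (≡true⇒T b₀) (≡true⇒T bᵢ)
  ...   | ()
... | false = ∑-AtMostOne≤1 (b ∘ suc) λ i j bi bj → suc-injective (unique (suc i) (suc j) bi bj)

∑-≟≤1 : ∀ {m} (x : Fin m) → ∑[ i < m ] [ ⌊ i ≟ x ⌋ ] ≤ 1
∑-≟≤1 x = ∑-AtMostOne≤1 (λ i → ⌊ i ≟ x ⌋) λ i j i≡x j≡x →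
  trans (toWitness i≡x) (sym (toWitness j≡x))

∑∑-symmetrise : ∀ {m} (f : Fin m → Fin m → ℕ) →
  ∑[ i < m ] ∑[ j < m ] (f i j + f j i) ≡ 2 * ∑[ i < m ] ∑[ j < m ] f i j
∑∑-symmetrise {m} f = begin
  ∑[ i < m ] ∑[ j < m ] (f i j + f j i)                    ≡⟨ sum-cong-≗ (λ i → ∑-distrib-+ (f i) (λ j → f j i)) ⟩
  ∑[ i < m ] (∑[ j < m ] f i j + ∑[ j < m ] f j i)          ≡⟨ ∑-distrib-+ (λ i → sum (f i)) (λ i → ∑[ j < m ] f j i) ⟩
  ∑[ i < m ] ∑[ j < m ] f i j + ∑[ i < m ] ∑[ j < m ] f j i ≡⟨ cong (S +_) (∑-comm (λ i j → f j i)) ⟩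
  S + S                                                      ≡⟨ cong (S +_) (sym (+-identityʳ S)) ⟩
  2 * S                                                      ∎
  where
  open ≡-Reasoning
  S = ∑[ i < m ] ∑[ j < m ] f i j

∑-≟-*≤ : ∀ {m} (x : Fin m) k → ∑[ i < m ] ([ ⌊ i ≟ x ⌋ ] * k) ≤ k
∑-≟-*≤ {m} x k = begin
  ∑[ i < m ] ([ ⌊ i ≟ x ⌋ ] * k) ≡⟨ *-distribʳ-sum k (λ i → [ ⌊ i ≟ x ⌋ ]) ⟨
  (∑[ i < m ] [ ⌊ i ≟ x ⌋ ]) * k ≤⟨ *-monoˡ-≤ k (∑-≟≤1 x) ⟩
  1 * k                         ≡⟨ *-identityˡ k ⟩
  k                             ∎
  where open ≤-Reasoning

1≤∑-≟ : ∀ {m} (x : Fin m) → 1 ≤ ∑[ i < m ] [ ⌊ i ≟ x ⌋ ]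
1≤∑-≟ {m} x = subst (_≤ ∑[ i < m ] [ ⌊ i ≟ x ⌋ ]) (cong (λ x≟x → [ ⌊ x≟x ⌋ ]) (≡-≟-identity _≟_ refl))
                    (term≤∑ (λ i → [ ⌊ i ≟ x ⌋ ]) x)

module _ {K : Set} {m : ℕ} (b : K → Fin m → Bool) where

  hits : List K → Fin m → ℕ
  hits L i = List.sum (map (λ k → [ b k i ]) L)

  ∑-hits≤length : (∀ k → AtMostOne (b k)) → ∀ L → ∑[ i < m ] hits L i ≤ length L
  ∑-hits≤length unique []      = ≤-reflexive (sum-replicate-zero m)
  ∑-hits≤length unique (k ∷ L) = begin
    ∑[ i < m ] ([ b k i ] + hits L i)          ≡⟨ ∑-distrib-+ (λ i → [ b k i ]) (hits L) ⟩
    ∑[ i < m ] [ b k i ] + ∑[ i < m ] hits L i ≤⟨ +-mono-≤ (∑-AtMostOne≤1 (b k) (unique k)) (∑-hits≤length unique L) ⟩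
    suc (length L)                            ∎
    where open ≤-Reasoning

  ∈⇒1≤hits : ∀ {k L i} → k ∈ L → T (b k i) → 1 ≤ hits L i
  ∈⇒1≤hits (here refl) bki = ≤-trans (≤-reflexive (sym (T⇒[]≡1 bki))) (m≤m+n _ _)
  ∈⇒1≤hits (there k∈L) bki = ≤-trans (∈⇒1≤hits k∈L bki) (m≤n+m _ _)

sum-tabulate : ∀ {m} (f : Fin m → ℕ) → List.sum (tabulate f) ≡ sum f
sum-tabulate {zero}  f = refl
sum-tabulate {suc m} f = cong (f zero +_) (sum-tabulate (f ∘ suc))

sum-map-cartesianProduct : ∀ {A B : Set} (f : A × B → ℕ) xs ys →
  List.sum (map f (cartesianProduct xs ys)) ≡ List.sum (map (λ x → List.sum (map (λ y → f (x , y)) ys)) xs)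
sum-map-cartesianProduct f []       ys = refl
sum-map-cartesianProduct f (x ∷ xs) ys = begin
  List.sum (map f (map (x ,_) ys ++ cartesianProduct xs ys))
    ≡⟨ cong List.sum (map-++ f (map (x ,_) ys) _) ⟩
  List.sum (map f (map (x ,_) ys) ++ map f (cartesianProduct xs ys))
    ≡⟨ sum-++ (map f (map (x ,_) ys)) _ ⟩
  List.sum (map f (map (x ,_) ys)) + List.sum (map f (cartesianProduct xs ys))
    ≡⟨ cong₂ _+_ (cong List.sum (sym (map-∘ ys))) (sum-map-cartesianProduct f xs ys) ⟩
  List.sum (map (λ y → f (x , y)) ys) + List.sum (map (λ x → List.sum (map (λ y → f (x , y)) ys)) xs) ∎
  where open ≡-Reasoning

sum-map-allFin² : ∀ {m} (f : Fin m × Fin m → ℕ) →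
  List.sum (map f (cartesianProduct (allFin m) (allFin m))) ≡ ∑[ i < m ] ∑[ j < m ] f (i , j)
sum-map-allFin² {m} f = begin
  List.sum (map f (cartesianProduct (allFin m) (allFin m)))
    ≡⟨ sum-map-cartesianProduct f (allFin m) (allFin m) ⟩
  List.sum (map (λ i → List.sum (map (λ j → f (i , j)) (allFin m))) (allFin m))
    ≡⟨ sum-map-allFin (λ i → List.sum (map (λ j → f (i , j)) (allFin m))) ⟩
  ∑[ i < m ] List.sum (map (λ j → f (i , j)) (allFin m))
    ≡⟨ sum-cong-≗ (λ i → sum-map-allFin (λ j → f (i , j))) ⟩
  ∑[ i < m ] ∑[ j < m ] f (i , j) ∎
  where
  open ≡-Reasoning
  sum-map-allFin : (g : Fin m → ℕ) → List.sum (map g (allFin m)) ≡ sum g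
  sum-map-allFin g = trans (cong List.sum (map-tabulate id g)) (sum-tabulate g)

AllPairs⇒injective : ∀ {m} {X : Set} (f : Fin m → X) → AllPairs _≢_ (tabulate f) → Injective _≡_ _≡_ f
AllPairs⇒injective f (f₀≢ ∷ distinct) {zero}  {zero}  _   = refl
AllPairs⇒injective f (f₀≢ ∷ distinct) {zero}  {suc j} f≡ = contradiction f≡ (All.tabulate⁻ f₀≢ j)
AllPairs⇒injective f (f₀≢ ∷ distinct) {suc i} {zero}  f≡ = contradiction (sym f≡) (All.tabulate⁻ f₀≢ i)
AllPairs⇒injective f (f₀≢ ∷ distinct) {suc i} {suc j} f≡ = cong suc (AllPairs⇒injective (f ∘ suc) distinct f≡)

VertexSet : ℕ → Set
VertexSet n = Fin n → Bool

card : ∀ {n} → VertexSet n → ℕ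
card {n} A = ∑[ x < n ] [ A x ]

_─_ : ∀ {n} → VertexSet n → Fin n → VertexSet n
(A ─ x) i = not ⌊ i ≟ x ⌋ ∧ A i

card-─ : ∀ {n} (A : VertexSet n) {x} → T (A x) → suc (card (A ─ x)) ≤ card A
card-─ {n} A {x} x∈A = begin
  suc (card (A ─ x))                                ≡⟨ +-comm 1 (card (A ─ x)) ⟩
  card (A ─ x) + 1                                  ≤⟨ +-monoʳ-≤ (card (A ─ x)) (1≤∑-≟ x) ⟩
  card (A ─ x) + ∑[ i < n ] [ ⌊ i ≟ x ⌋ ]           ≡⟨ ∑-distrib-+ (λ i → [ (A ─ x) i ]) (λ i → [ ⌊ i ≟ x ⌋ ]) ⟨
  ∑[ i < n ] ([ (A ─ x) i ] + [ ⌊ i ≟ x ⌋ ])        ≡⟨ sum-cong-≗ split ⟨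
  card A                                            ∎
  where
  open ≤-Reasoning
  split : ∀ i → [ A i ] ≡ [ (A ─ x) i ] + [ ⌊ i ≟ x ⌋ ]
  split i with i ≟ x
  ... | yes refl = T⇒[]≡1 x∈A
  ... | no _     = sym (+-identityʳ _)

module _ {n} (G : SimpleGraph n) where

  deg : VertexSet n → Fin n → ℕ
  deg A x = ∑[ y < n ] [ A y ∧ adj G x y ]

  adjIn : VertexSet n → Fin n → Fin n → Bool
  adjIn A x y = A x ∧ (A y ∧ adj G x y)

  degreeSum : VertexSet n → ℕ
  degreeSum A = ∑[ x < n ] ∑[ y < n ] [ adjIn A x y ]

  adjIn-sym : ∀ A x y → adjIn A x y ≡ adjIn A y x
  adjIn-sym A x y with A x | A y
  ... | true  | true  = SimpleGraph.sym G x y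
  ... | true  | false = refl
  ... | false | true  = refl
  ... | false | false = refl

  adjIn-─ : ∀ A x i j → [ adjIn A i j ] ≤
    [ adjIn (A ─ x) i j ] + ([ ⌊ i ≟ x ⌋ ] * [ A j ∧ adj G x j ] + [ ⌊ j ≟ x ⌋ ] * [ A i ∧ adj G x i ])
  adjIn-─ A x i j with i ≟ x | j ≟ x
  ... | yes refl | _        = ≤-trans ([∧]≤ʳ (A i) _) (≤-trans (≤-reflexive (sym (*-identityˡ _))) (m≤m+n _ _))
  ... | no _     | yes refl = ≤-trans (≤-trans (in-flipped (A i) (A j)) (m≤m+n _ 0)) (m≤n+m _ [ A i ∧ false ])
    where
    in-flipped : ∀ a b → [ a ∧ (b ∧ adj G i j) ] ≤ [ a ∧ adj G j i ]
    in-flipped true  true  = ≤-reflexive (cong [_] (SimpleGraph.sym G i j))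
    in-flipped true  false = z≤n
    in-flipped false _     = z≤n
  ... | no _     | no _     = m≤m+n _ _

  degreeSum-─ : ∀ A x → degreeSum A ≤ degreeSum (A ─ x) + 2 * deg A x
  degreeSum-─ A x = begin
    degreeSum A
      ≤⟨ ∑-mono-≤ (λ i → ∑-mono-≤ (adjIn-─ A x i)) ⟩
    ∑[ i < n ] ∑[ j < n ] ([ adjIn (A ─ x) i j ] + (at i (D j) + at j (D i)))
      ≡⟨ sum-cong-≗ (λ i → ∑-distrib-+ (λ j → [ adjIn (A ─ x) i j ]) (λ j → at i (D j) + at j (D i))) ⟩
    ∑[ i < n ] (∑[ j < n ] [ adjIn (A ─ x) i j ] + ∑[ j < n ] (at i (D j) + at j (D i)))
      ≡⟨ ∑-distrib-+ (λ i → ∑[ j < n ] [ adjIn (A ─ x) i j ]) (λ i → ∑[ j < n ] (at i (D j) + at j (D i))) ⟩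
    degreeSum (A ─ x) + ∑[ i < n ] ∑[ j < n ] (at i (D j) + at j (D i))
      ≡⟨ cong (degreeSum (A ─ x) +_) (trans (sum-cong-≗ λ i → ∑-distrib-+ (λ j → at i (D j)) (λ j → at j (D i)))
                                              (∑-distrib-+ (λ i → ∑[ j < n ] at i (D j)) (λ i → ∑[ j < n ] at j (D i)))) ⟩
    degreeSum (A ─ x) + (∑[ i < n ] ∑[ j < n ] at i (D j) + ∑[ i < n ] ∑[ j < n ] at j (D i))
      ≤⟨ +-monoʳ-≤ (degreeSum (A ─ x)) (+-mono-≤ row column) ⟩
    degreeSum (A ─ x) + (deg A x + (deg A x + 0))
      ∎
    where
    open ≤-Reasoning
    D : Fin n → ℕ
    D y = [ A y ∧ adj G x y ]
    at : Fin n → ℕ → ℕ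
    at i k = [ ⌊ i ≟ x ⌋ ] * k
    row : ∑[ i < n ] ∑[ j < n ] at i (D j) ≤ deg A x
    row = ≤-trans (≤-reflexive (sum-cong-≗ λ i → sym (*-distribˡ-sum [ ⌊ i ≟ x ⌋ ] D))) (∑-≟-*≤ x (deg A x))
    column : ∑[ i < n ] ∑[ j < n ] at j (D i) ≤ deg A x + 0
    column = ≤-trans (∑-mono-≤ (λ i → ∑-≟-*≤ x (D i))) (m≤m+n _ _)

  MinDegree≥ : ℕ → VertexSet n → Set
  MinDegree≥ d A = ∀ x → T (A x) → d ≤ deg A x

  degreeSum≤-byPeeling : ∀ k → (∀ A → MinDegree≥ (suc k) A → degreeSum A ≤ 2 * k * card A) →
                         ∀ A → degreeSum A ≤ 2 * k * card A
  degreeSum≤-byPeeling k core A = peel (card A) A ≤-refl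
    where
    peel : ∀ s A → card A ≤ s → degreeSum A ≤ 2 * k * card A
    peel s A size with any? (λ x → T? (A x) ×-dec deg A x ≤? k)
    ... | no noLowVertex = core A (λ x x∈A → ≰⇒> (λ low → noLowVertex (x , x∈A , low)))
    peel zero A size | yes (x , x∈A , _) = contradiction (≤-trans (card-─ A x∈A) size) λ ()
    peel (suc s) A size | yes (x , x∈A , low) = begin
      degreeSum A                                   ≤⟨ degreeSum-─ A x ⟩
      degreeSum (A ─ x) + 2 * deg A x               ≤⟨ +-mono-≤ ih (*-monoʳ-≤ 2 low) ⟩
      2 * k * card (A ─ x) + 2 * k                  ≡⟨ +-comm (2 * k * card (A ─ x)) (2 * k) ⟩
      2 * k + 2 * k * card (A ─ x)                  ≡⟨ *-suc (2 * k) (card (A ─ x)) ⟨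
      2 * k * suc (card (A ─ x))                    ≤⟨ *-monoʳ-≤ (2 * k) (card-─ A x∈A) ⟩
      2 * k * card A                                ∎
      where
      open ≤-Reasoning
      ih : degreeSum (A ─ x) ≤ 2 * k * card (A ─ x)
      ih = peel s (A ─ x) (≤-pred (≤-trans (card-─ A x∈A) size))

  degreeSum-discharge : ∀ A (charge : Fin n → Fin n → ℕ) →
    (∀ x y → T (adjIn A x y) → charge x y + charge y x ≡ 2) →
    degreeSum A ≡ ∑[ x < n ] ∑[ y < n ] ([ adjIn A x y ] * charge x y)
  degreeSum-discharge A charge shares = *-cancelˡ-≡ (degreeSum A) _ 2 (begin
    2 * degreeSum A                                                ≡⟨ *-distribˡ-sum 2 (λ x → ∑[ y < n ] [ adjIn A x y ]) ⟩
    ∑[ x < n ] (2 * ∑[ y < n ] [ adjIn A x y ])                     ≡⟨ sum-cong-≗ (λ x → *-distribˡ-sum 2 (λ y → [ adjIn A x y ])) ⟩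
    ∑[ x < n ] ∑[ y < n ] (2 * [ adjIn A x y ])                     ≡⟨ sum-cong-≗ (λ x → sum-cong-≗ (split x)) ⟩
    ∑[ x < n ] ∑[ y < n ] (received x y + received y x)              ≡⟨ ∑∑-symmetrise received ⟩
    2 * ∑[ x < n ] ∑[ y < n ] received x y                          ∎)
    where
    open ≡-Reasoning
    received : Fin n → Fin n → ℕ
    received x y = [ adjIn A x y ] * charge x y
    split : ∀ x y → 2 * [ adjIn A x y ] ≡ received x y + received y x
    split x y rewrite adjIn-sym A y x with adjIn A x y in xy
    ... | false = refl
    ... | true  = sym (trans (cong₂ _+_ (+-identityʳ (charge x y)) (+-identityʳ (charge y x)))
                             (shares x y (≡true⇒T xy)))

  degreeSum-all≡2*edgeCount : degreeSum (λ _ → true) ≡ 2 * edgeCount G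
  degreeSum-all≡2*edgeCount = begin
    ∑[ i < n ] ∑[ j < n ] [ adj G i j ]             ≡⟨ sum-cong-≗ (λ i → sum-cong-≗ (split i)) ⟩
    ∑[ i < n ] ∑[ j < n ] (forward i j + forward j i) ≡⟨ ∑∑-symmetrise forward ⟩
    2 * ∑[ i < n ] ∑[ j < n ] forward i j           ≡⟨ cong (2 *_) (sum-map-allFin² (λ (i , j) → forward i j)) ⟨
    2 * edgeCount G                                 ∎
    where
    open ≡-Reasoning
    forward : Fin n → Fin n → ℕ
    forward i j = [ (toℕ i <ᵇ toℕ j) ∧ adj G i j ]
    false≢ : ∀ {m k} → (m <ᵇ k) ≡ false → ¬ m < k
    false≢ m≮ᵇk m<k = subst T m≮ᵇk (<⇒<ᵇ m<k)
    split : ∀ i j → [ adj G i j ] ≡ forward i j + forward j i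
    split i j with toℕ i <ᵇ toℕ j in ij | toℕ j <ᵇ toℕ i in ji
    ... | true  | true  =
      contradiction (<ᵇ⇒< (toℕ j) (toℕ i) (≡true⇒T ji)) (<⇒≯ (<ᵇ⇒< (toℕ i) (toℕ j) (≡true⇒T ij)))
    ... | true  | false = sym (+-identityʳ _)
    ... | false | true  = cong [_] (SimpleGraph.sym G i j)
    ... | false | false = cong [_] (subst (λ k → adj G i k ≡ false) i≡j (irrefl G i))
      where i≡j = toℕ-injective (≤-antisym (≮⇒≥ (false≢ {toℕ j} ji)) (≮⇒≥ (false≢ {toℕ i} ij)))

module _ {n} {G : SimpleGraph n} {c : EdgeColouring G} (proper : Proper c) where

  open DecMembership (_≟_ {n}) using (_∈?_)
  open DecMembership ℕ._≟_ using () renaming (_∈?_ to _∈ℕ?_)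

  adj-sym : ∀ {x y} → T (adj G x y) → T (adj G y x)
  adj-sym {x} {y} = subst T (SimpleGraph.sym G x y)

  adj⇒≢ : ∀ {x y} → T (adj G x y) → x ≢ y
  adj⇒≢ {x} xy refl = subst T (irrefl G x) xy

  consecutive-colours-differ : ∀ {x y z} → T (adj G x y) → T (adj G y z) → x ≢ z → col c x y ≢ col c y z
  consecutive-colours-differ {x} {y} {z} xy yz x≢z xy≡yz =
    proper y x z (adj-sym xy) yz x≢z (trans (sym (colSym c x y xy)) xy≡yz)

  -- Each vertex of L excludes one neighbour of x and, by properness, so does each colour of M.
  avoiding-neighbour : ∀ A x (L : List (Fin n)) (M : List ℕ) → length L + length M < deg G A x →
    ∃[ y ] T (A y) × T (adj G x y) × All (y ≢_) L × All (col c x y ≢_) M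
  avoiding-neighbour A x L M many
    with any? (λ y → T? (A y) ×-dec T? (adj G x y) ×-dec ¬? (y ∈? L) ×-dec ¬? (col c x y ∈ℕ? M))
  ... | yes (y , y∈A , xy , y∉L , xy∉M) = y , y∈A , xy , All.¬Any⇒All¬ L y∉L , All.¬Any⇒All¬ M xy∉M
  ... | no none = contradiction many (≤⇒≯ (begin
    deg G A x                                                 ≤⟨ ∑-mono-≤ covered ⟩
    ∑[ y < n ] (hits vertexIs L y + hits colourIs M y)         ≡⟨ ∑-distrib-+ (hits vertexIs L) (hits colourIs M) ⟩
    ∑[ y < n ] hits vertexIs L y + ∑[ y < n ] hits colourIs M y ≤⟨ +-mono-≤ (∑-hits≤length vertexIs vertexIs-unique L)
                                                                           (∑-hits≤length colourIs colourIs-unique M) ⟩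
    length L + length M                                       ∎))
    where
    open ≤-Reasoning
    vertexIs : Fin n → Fin n → Bool
    vertexIs l y = ⌊ y ≟ l ⌋
    colourIs : ℕ → Fin n → Bool
    colourIs m y = adj G x y ∧ ⌊ col c x y ℕ.≟ m ⌋
    vertexIs-unique : ∀ l → AtMostOne (vertexIs l)
    vertexIs-unique l y z y≡l z≡l = trans (toWitness y≡l) (sym (toWitness z≡l))
    colourIs-unique : ∀ m → AtMostOne (colourIs m)
    colourIs-unique m y z xy≡m xz≡m with y ≟ z
    ... | yes y≡z = y≡z
    ... | no  y≢z with Equivalence.to T-∧ xy≡m | Equivalence.to T-∧ xz≡m
    ...   | xy , col≡m | xz , col′≡m =
      contradiction (trans (toWitness col≡m) (sym (toWitness col′≡m))) (proper x y z xy xz y≢z)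
    covered : ∀ y → [ A y ∧ adj G x y ] ≤ hits vertexIs L y + hits colourIs M y
    covered y with A y ∧ adj G x y in y∼x
    ... | false = z≤n
    ... | true with Equivalence.to (T-∧ {A y}) (≡true⇒T y∼x) | y ∈? L | col c x y ∈ℕ? M
    ...   | _         , _  | yes y∈L | _        = ≤-trans (∈⇒1≤hits vertexIs y∈L (fromWitness refl)) (m≤m+n _ _)
    ...   | _         , xy | no _    | yes xy∈M =
      ≤-trans (∈⇒1≤hits colourIs xy∈M (Equivalence.from (T-∧ {adj G x y}) (xy , fromWitness refl))) (m≤n+m _ _)
    ...   | y∈A       , xy | no y∉L  | no xy∉M  = contradiction (y , y∈A , xy , y∉L , xy∉M) none

  rainbowP5 : ∀ {x₀ x₁ x₂ x₃ x₄ x₅} →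
    AllPairs _≢_ (x₀ ∷ x₁ ∷ x₂ ∷ x₃ ∷ x₄ ∷ x₅ ∷ []) →
    T (adj G x₀ x₁) → T (adj G x₁ x₂) → T (adj G x₂ x₃) → T (adj G x₃ x₄) → T (adj G x₄ x₅) →
    AllPairs _≢_ (col c x₀ x₁ ∷ col c x₁ x₂ ∷ col c x₂ x₃ ∷ col c x₃ x₄ ∷ col c x₄ x₅ ∷ []) →
    RainbowP5 c
  rainbowP5 {x₀} {x₁} {x₂} {x₃} {x₄} {x₅} distinct x₀x₁ x₁x₂ x₂x₃ x₃x₄ x₄x₅ rainbow =
    vertex , AllPairs⇒injective vertex distinct , adjacent , AllPairs⇒injective _ rainbow
    where
    vertex : Fin 6 → Fin n
    vertex = Vec.lookup (x₀ ∷ x₁ ∷ x₂ ∷ x₃ ∷ x₄ ∷ x₅ ∷ [])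
    adjacent : ∀ (k : Fin 5) → T (adj G (vertex (inject₁ k)) (vertex (suc k)))
    adjacent zero                         = x₀x₁
    adjacent (suc zero)                   = x₁x₂
    adjacent (suc (suc zero))             = x₂x₃
    adjacent (suc (suc (suc zero)))       = x₃x₄
    adjacent (suc (suc (suc (suc zero)))) = x₄x₅

  module FiveCore (noP5 : ¬ RainbowP5 c) (A : VertexSet n) (minDeg : MinDegree≥ G 5 A) where

    Big : Fin n → Set
    Big v = 8 ≤ deg G A v

    -- Consecutive vertices differ by irreflexivity and consecutive colours by properness.
    record RainbowP₃ (v p q r : Fin n) : Set where
      field
        v≢q : v ≢ q
        v≢r : v ≢ r
        p≢r : p ≢ r
        vp  : T (adj G v p)
        pq  : T (adj G p q)
        qr  : T (adj G q r)
        vp≢qr : col c v p ≢ col c q r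

    rainbowP₃-from-big-unextendable : ∀ {v p q r s} → Big v → RainbowP₃ v p q r → T (adj G r s) →
      All (s ≢_) (v ∷ p ∷ q ∷ []) → All (col c r s ≢_) (col c v p ∷ col c p q ∷ []) → ⊥
    rainbowP₃-from-big-unextendable {v} {p} {q} {r} {s} big P rs (s≢v ∷ s≢p ∷ s≢q ∷ []) (rs≢vp ∷ rs≢pq ∷ [])
      with avoiding-neighbour A v (p ∷ q ∷ r ∷ s ∷ []) (col c p q ∷ col c q r ∷ col c r s ∷ []) big
    ... | w , _ , vw , w≢p ∷ w≢q ∷ w≢r ∷ w≢s ∷ [] , vw≢pq ∷ vw≢qr ∷ vw≢rs ∷ [] = noP5 (rainbowP5
      ((≢-sym (adj⇒≢ vw) ∷ w≢p ∷ w≢q ∷ w≢r ∷ w≢s ∷ []) ∷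
       (adj⇒≢ vp ∷ v≢q ∷ v≢r ∷ ≢-sym s≢v ∷ []) ∷
       (adj⇒≢ pq ∷ p≢r ∷ ≢-sym s≢p ∷ []) ∷
       (adj⇒≢ qr ∷ ≢-sym s≢q ∷ []) ∷
       (adj⇒≢ rs ∷ []) ∷ [] ∷ [])
      (adj-sym vw) vp pq qr rs
      ((wv≢ (proper v w p vw vp w≢p) ∷ wv≢ vw≢pq ∷ wv≢ vw≢qr ∷ wv≢ vw≢rs ∷ []) ∷
       (consecutive-colours-differ vp pq v≢q ∷ vp≢qr ∷ ≢-sym rs≢vp ∷ []) ∷
       (consecutive-colours-differ pq qr p≢r ∷ ≢-sym rs≢pq ∷ []) ∷
       (consecutive-colours-differ qr rs (≢-sym s≢q) ∷ []) ∷ [] ∷ []))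
      where
      open RainbowP₃ P
      wv≢ : ∀ {k} → col c v w ≢ k → col c w v ≢ k
      wv≢ vw≢k wv≡k = vw≢k (trans (colSym c v w vw) wv≡k)

    rainbowP₃-from-big-end-degree≤5 : ∀ {v p q r} → Big v → RainbowP₃ v p q r → deg G A r ≤ 5
    rainbowP₃-from-big-end-degree≤5 {v} {p} {q} {r} big P = ≮⇒≥ λ many →
      let s , _ , rs , s∉ , rs∉ = avoiding-neighbour A r (v ∷ p ∷ q ∷ []) (col c v p ∷ col c p q ∷ []) many
      in rainbowP₃-from-big-unextendable big P rs s∉ rs∉

    rainbowP₃-from-big-end-adjacent : ∀ {v p q r} → Big v → RainbowP₃ v p q r → T (A r) → T (adj G r p) × T (adj G r v)
    rainbowP₃-from-big-end-adjacent {v} {p} {q} {r} big P r∈A = r∼p , r∼v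
      where
      r∼p : T (adj G r p)
      r∼p with T? (adj G r p)
      ... | yes rp = rp
      ... | no ¬rp with avoiding-neighbour A r (v ∷ q ∷ []) (col c v p ∷ col c p q ∷ []) (minDeg r r∈A)
      ...   | s , _ , rs , s≢v ∷ s≢q ∷ [] , rs∉ =
        ⊥-elim (rainbowP₃-from-big-unextendable big P rs (s≢v ∷ (λ { refl → ¬rp rs }) ∷ s≢q ∷ []) rs∉)
      r∼v : T (adj G r v)
      r∼v with T? (adj G r v)
      ... | yes rv = rv
      ... | no ¬rv with avoiding-neighbour A r (p ∷ q ∷ []) (col c v p ∷ col c p q ∷ []) (minDeg r r∈A)
      ...   | s , _ , rs , s≢p ∷ s≢q ∷ [] , rs∉ =
        ⊥-elim (rainbowP₃-from-big-unextendable big P rs ((λ { refl → ¬rv rs }) ∷ s≢p ∷ s≢q ∷ []) rs∉)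

    -- A neighbour b ∉ {u, v} of a with c(ab) ≠ c(vu) makes v u a b rainbow, so b ∼ u, v,
    -- and then v u b a is rainbow as well.
    big-second-neighbour : ∀ {v u a} → Big v → T (adj G v u) → T (A a) → T (adj G u a) → a ≢ v →
      deg G A a ≤ 5 × ∃[ b ] T (A b) × T (adj G v b) × T (adj G b u)
    big-second-neighbour {v} {u} {a} big vu a∈A ua a≢v
      with avoiding-neighbour A a (u ∷ v ∷ []) (col c v u ∷ []) (<⇒≤ (minDeg a a∈A))
    ... | b , b∈A , ab , b≢u ∷ b≢v ∷ [] , ab≢vu ∷ [] =
      rainbowP₃-from-big-end-degree≤5 big vuba , b , b∈A , adj-sym bv , bu
      where
      vuab : RainbowP₃ v u a b
      vuab = record { v≢q = ≢-sym a≢v ; v≢r = ≢-sym b≢v ; p≢r = ≢-sym b≢u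
                    ; vp = vu ; pq = ua ; qr = ab ; vp≢qr = ≢-sym ab≢vu }
      bu = proj₁ (rainbowP₃-from-big-end-adjacent big vuab b∈A)
      bv = proj₂ (rainbowP₃-from-big-end-adjacent big vuab b∈A)
      vuba : RainbowP₃ v u b a
      vuba = record { v≢q = ≢-sym b≢v ; v≢r = ≢-sym a≢v ; p≢r = adj⇒≢ ua
                    ; vp = vu ; pq = adj-sym bu ; qr = adj-sym ab
                    ; vp≢qr = λ vu≡ba → ab≢vu (trans (colSym c a b ab) (sym vu≡ba)) }

    big-neighbour-degree≤5 : ∀ {v x} → Big v → T (A x) → T (adj G v x) → deg G A x ≤ 5
    big-neighbour-degree≤5 {v} {x} big x∈A vx
      with avoiding-neighbour A x (v ∷ []) [] (≤-trans (m≤m+n 2 3) (minDeg x x∈A))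
    ... | a , a∈A , xa , a≢v ∷ [] , [] with big-second-neighbour big vx a∈A xa a≢v
    ...   | _ , b , _ , vb , bx = proj₁ (big-second-neighbour big vb x∈A bx (≢-sym (adj⇒≢ vx)))

    big⇒¬degree≤5 : ∀ {x} → Big x → ¬ deg G A x ≤ 5
    big⇒¬degree≤5 big small = <-irrefl refl (≤-trans big (≤-trans small (m≤m+n 5 2)))

    big? : Fin n → Bool
    big? x = ⌊ 8 ≤? deg G A x ⌋

    big-neighbour⁻ : ∀ {x w} → T ((A w ∧ adj G x w) ∧ big? w) → T (A w) × T (adj G x w) × Big w
    big-neighbour⁻ {x} {w} t with Equivalence.to (T-∧ {A w ∧ adj G x w}) t
    ... | w∼x , w-big with Equivalence.to (T-∧ {A w}) w∼x
    ...   | w∈A , xw = w∈A , xw , toWitness w-big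

    atMostOne-big-neighbour : ∀ x → AtMostOne (λ y → (A y ∧ adj G x y) ∧ big? y)
    atMostOne-big-neighbour x y z y-big z-big with y ≟ z
    ... | yes y≡z = y≡z
    ... | no  y≢z with big-neighbour⁻ y-big | big-neighbour⁻ z-big
    ...   | _ , xy , y-Big | z∈A , xz , z-Big =
      contradiction (proj₁ (big-second-neighbour y-Big (adj-sym xy) z∈A xz (≢-sym y≢z))) (big⇒¬degree≤5 z-Big)

    charge : Fin n → Fin n → ℕ
    charge x y = if big? x then 0 else if big? y then 2 else 1

    charge-shared : ∀ x y → T (adjIn G A x y) → charge x y + charge y x ≡ 2
    charge-shared x y x∼y with Equivalence.to (T-∧ {A x}) x∼y
    ... | x∈A , y∼x with Equivalence.to (T-∧ {A y}) y∼x
    ...   | y∈A , xy with big? x in x-big | big? y in y-big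
    ...     | true  | true  = contradiction (big-neighbour-degree≤5 (toWitness (≡true⇒T x-big)) y∈A xy)
                                            (big⇒¬degree≤5 (toWitness (≡true⇒T y-big)))
    ...     | true  | false = refl
    ...     | false | true  = refl
    ...     | false | false = refl

    charge-received : ∀ x → ∑[ y < n ] ([ adjIn G A x y ] * charge x y) ≤ 8 * [ A x ]
    charge-received x with A x | big? x in x-big
    ... | false | _     = ≤-reflexive (sum-replicate-zero n)
    ... | true  | true  =
      ≤-trans (≤-reflexive (trans (sum-cong-≗ λ y → *-zeroʳ [ A y ∧ adj G x y ]) (sum-replicate-zero n))) z≤n
    ... | true  | false = begin
      ∑[ y < n ] ([ A y ∧ adj G x y ] * (if big? y then 2 else 1))
        ≡⟨ sum-cong-≗ (λ y → [_]*-weight (A y ∧ adj G x y) (big? y)) ⟩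
      ∑[ y < n ] ([ A y ∧ adj G x y ] + [ (A y ∧ adj G x y) ∧ big? y ])
        ≡⟨ ∑-distrib-+ (λ y → [ A y ∧ adj G x y ]) (λ y → [ (A y ∧ adj G x y) ∧ big? y ]) ⟩
      deg G A x + ∑[ y < n ] [ (A y ∧ adj G x y) ∧ big? y ]
        ≤⟨ +-mono-≤ (≤-pred (≰⇒> (toWitnessFalse (Equivalence.from T-not-≡ x-big))))
                    (∑-AtMostOne≤1 _ (atMostOne-big-neighbour x)) ⟩
      8 ∎
      where
      open ≤-Reasoning
      [_]*-weight : ∀ a b → [ a ] * (if b then 2 else 1) ≡ [ a ] + [ a ∧ b ]
      [ true  ]*-weight true  = refl
      [ true  ]*-weight false = refl
      [ false ]*-weight _     = refl

    degreeSum≤8*card : degreeSum G A ≤ 8 * card A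
    degreeSum≤8*card = begin
      degreeSum G A                                             ≡⟨ degreeSum-discharge G A charge charge-shared ⟩
      ∑[ x < n ] ∑[ y < n ] ([ adjIn G A x y ] * charge x y)   ≤⟨ ∑-mono-≤ charge-received ⟩
      ∑[ x < n ] (8 * [ A x ])                                  ≡⟨ *-distribˡ-sum 8 (λ x → [ A x ]) ⟨
      8 * card A                                                ∎
      where open ≤-Reasoning

theorem11 : (n : ℕ) → 1 ≤ n → (G : SimpleGraph n) → (c : EdgeColouring G) →
    Proper c → ¬ RainbowP5 c → edgeCount G ≤ 4 * n
theorem11 n _ G c proper noP5 = *-cancelˡ-≤ 2 (begin
  2 * edgeCount G          ≡⟨ degreeSum-all≡2*edgeCount G ⟨
  degreeSum G whole        ≤⟨ degreeSum≤-byPeeling G 4 (FiveCore.degreeSum≤8*card {c = c} proper noP5) whole ⟩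
  8 * card whole           ≡⟨ cong (8 *_) (∑-one n) ⟩
  8 * n                    ≡⟨ *-assoc 2 4 n ⟩
  2 * (4 * n)              ∎)
  where
  open ≤-Reasoning
  whole : VertexSet n
  whole _ = true
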